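{- Let $\mathbf{P}$ be a downward-directed poset and let $\mathcal{D}(\mathbf{P})$ denote the frame (complete Heyting algebra) of down-sets of $\mathbf{P}$, ordered by inclusion. Let $j:\mathcal{D}(\mathbf{P})\to\mathcal{D}(\mathbf{P})$ be a nucleus. Define $$X_j=\{p\in\mathbf{P} : p\notin j(\downarrow p\setminus\{p\})\},$$ for each $p\in\mathbf{P}$ define $J_j(p)=\{S\in\mathcal{D}(\downarrow p) : p\in j(S)\}$, and define $$X_{J_j}=\{p\in\mathbf{P} : J_j(p)=\{\downarrow p\}\}=\{p\in\mathbf{P} : \forall S\in\mathcal{D}(\downarrow p).\ (p\in j(S))\leftrightarrow (S=\downarrow p)\}.$$ Then $X_j=X_{J_j}$.
   Context: For $p\in\mathbf{P}$, $\downarrow p=\{q\in\mathbf{P}: q\le p\}$, and $\mathcal{D}(\downarrow p)$ denotes the set of down-sets of $\mathbf{P}$ contained in $\downarrow p$ (equivalently, down-sets of the poset $\downarrow p$). The frame $\mathcal{D}(\mathbf{P})$ plays the role of the Heyting algebra $\mathrm{Sub}(1)$ of subterminal objects of the presheaf topos on $\mathbf{P}$. A nucleus on $\mathcal{D}(\mathbf{P})$ is a map $j$ such that for all down-sets $S,T$: $S\subseteq j(S)$, $j(j(S))=j(S)$, and $j(S\cap T)=j(S)\cap j(T)$ (in particular $j$ is monotone). -}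

module Defs where

open import Level using (Level; _⊔_; suc)
open import Data.Product using (Σ; _×_; _,_; proj₁; ∃-syntax)
open import Relation.Nullary using (¬_)
open import Relation.Unary using (Pred; _∈_; _∉_; _⊆_; _∩_)
open import Relation.Binary.Bundles using (Poset)
open import Function.Bundles using (_⇔_)

module _ {c ℓ : Level} (P : Poset c ℓ ℓ) where
  open Poset P

  -- downward-directed: nonempty, and any two elements have a common lower bound
  DownwardDirected : Set (c ⊔ ℓ)
  DownwardDirected = Carrier × (∀ p q → ∃[ r ] (r ≤ p × r ≤ q))

  IsDownSet : Pred Carrier ℓ → Set (c ⊔ ℓ)
  IsDownSet S = ∀ {q r} → q ≤ r → r ∈ S → q ∈ S

  DownSet : Set (c ⊔ suc ℓ)
  DownSet = Σ (Pred Carrier ℓ) IsDownSet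

  _∈D_ : Carrier → DownSet → Set ℓ
  p ∈D S = p ∈ proj₁ S

  _⊆D_ : DownSet → DownSet → Set (c ⊔ ℓ)
  S ⊆D T = proj₁ S ⊆ proj₁ T

  _≐D_ : DownSet → DownSet → Set (c ⊔ ℓ)
  S ≐D T = (S ⊆D T) × (T ⊆D S)

  _∩D_ : DownSet → DownSet → DownSet
  (S , dS) ∩D (T , dT) = (S ∩ T) , λ q≤r (rS , rT) → dS q≤r rS , dT q≤r rT

  ↓_ : Carrier → DownSet
  ↓ p = (λ q → q ≤ p) , λ q≤r r≤p → trans q≤r r≤p

  ↓∖_ : Carrier → DownSet
  ↓∖ p = (λ q → (q ≤ p) × ¬ (q ≈ p))
       , λ {q} {r} q≤r (r≤p , r≉p) →
           trans q≤r r≤p , λ q≈p → r≉p (antisym r≤p (trans (reflexive (Eq.sym q≈p)) q≤r))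

  -- Since down-sets are represented as predicates,
  -- equality of down-sets is extensional (≐D) and j is required to respect it
  -- (automatic for a set-theoretic function on 𝒟(P)).
  record Nucleus : Set (c ⊔ suc ℓ) where
    field
      j           : DownSet → DownSet
      j-cong      : ∀ {S T} → S ≐D T → j S ≐D j T
      inflationary : ∀ S → S ⊆D j S
      idempotent  : ∀ S → j (j S) ≐D j S
      preserves-∩ : ∀ S T → j (S ∩D T) ≐D (j S ∩D j T)

  module _ (N : Nucleus) where
    open Nucleus N

    X : Pred Carrier ℓ
    X p = ¬ (p ∈D j (↓∖ p))

    J : Carrier → DownSet → Set (c ⊔ ℓ)
    J p S = (S ⊆D (↓ p)) × (p ∈D j S)

    XJ : Pred Carrier (c ⊔ suc ℓ)
    XJ p = ∀ (S : DownSet) → S ⊆D (↓ p) → (p ∈D j S) ⇔ (S ≐D (↓ p))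

{-# OPTIONS --safe #-}
-- If p ∉ j(↓p ∖ {p}), a down-set S ⊆ ↓p with p ∈ j(S) must contain p (otherwise
-- S ⊆ ↓p ∖ {p} and monotonicity of j gives p ∈ j(↓p ∖ {p})), so S = ↓p; the
-- converse direction applies the defining property of X_{J_j} to S = ↓p ∖ {p}.
module Submission where

open import Defs
open import Level using (Level)
open import Data.Empty using (⊥-elim)
open import Data.Product using (_,_; proj₁; proj₂)
open import Relation.Nullary using (¬_; yes; no)
open import Relation.Binary.Bundles using (Poset)
open import Axiom.ExcludedMiddle using (ExcludedMiddle)
open import Function.Bundles using (_⇔_; mk⇔; Equivalence)

module _ {c ℓ : Level} (P : Poset c ℓ ℓ) where
  open Poset P

  ↓-⊆-downSet : ∀ (S : DownSet P) {p} → _∈D_ P p S → _⊆D_ P (↓_ P p) S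
  ↓-⊆-downSet (_ , isDown) p∈S q≤p = isDown q≤p p∈S

  ⊆↓∖-if-∉ : ∀ (S : DownSet P) {p} → _⊆D_ P S (↓_ P p) → ¬ _∈D_ P p S →
             _⊆D_ P S (↓∖_ P p)
  ⊆↓∖-if-∉ (_ , isDown) S⊆↓p p∉S q∈S =
    S⊆↓p q∈S , λ q≈p → p∉S (isDown (reflexive (Eq.sym q≈p)) q∈S)

  ↓∖≉↓ : ∀ p → ¬ _≐D_ P (↓∖_ P p) (↓_ P p)
  ↓∖≉↓ p (_ , ↓p⊆↓∖p) = proj₂ (↓p⊆↓∖p refl) Eq.refl

  module _ (N : Nucleus P) where
    open Nucleus N

    j-mono : ∀ S T → _⊆D_ P S T → _⊆D_ P (j S) (j T)
    j-mono S T S⊆T x∈jS =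
      proj₂ (proj₁ (preserves-∩ S T)
        (proj₁ (j-cong {S} {_∩D_ P S T} ((λ x∈S → x∈S , S⊆T x∈S) , proj₁)) x∈jS))

    X⇒XJ : ExcludedMiddle ℓ → ∀ {p} → X P N p → XJ P N p
    X⇒XJ em {p} p∉j↓∖p S S⊆↓p = mk⇔ to from
      where
      to : _∈D_ P p (j S) → _≐D_ P S (↓_ P p)
      to p∈jS with em {_∈D_ P p S}
      ... | yes p∈S = S⊆↓p , ↓-⊆-downSet S p∈S
      ... | no  p∉S = ⊥-elim (p∉j↓∖p (j-mono S (↓∖_ P p) (⊆↓∖-if-∉ S S⊆↓p p∉S) p∈jS))

      from : _≐D_ P S (↓_ P p) → _∈D_ P p (j S)
      from (_ , ↓p⊆S) = inflationary S (↓p⊆S refl)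

    XJ⇒X : ∀ {p} → XJ P N p → X P N p
    XJ⇒X {p} xj p∈j↓∖p = ↓∖≉↓ p (Equivalence.to (xj (↓∖_ P p) proj₁) p∈j↓∖p)

mainTheorem1 : {c ℓ : Level} → ExcludedMiddle ℓ → (P : Poset c ℓ ℓ) →
    DownwardDirected P → (N : Nucleus P) →
    ∀ p → X P N p ⇔ XJ P N p
mainTheorem1 em P _ N p = mk⇔ (X⇒XJ P N em) (XJ⇒X P N)
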